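{- Let $p$ be a prime, $n,r\geq1$ with $p>\binom{r+1}{2}$, and let $\mathscr{U}_{\mathfrak{L}_1},\ldots,\mathscr{U}_{\mathfrak{L}_r}$ be distinct hyperplanes over $\mathbb{F}_p^n$. Let $\mathbf{c}\in\mathbb{F}_p^n$ with $\mathbf{c}\notin\bigcup_{1\leq i<j\leq r}(\mathscr{U}_{\mathfrak{L}_i}\cap\mathscr{U}_{\mathfrak{L}_j})$. Then there exists $\vec v\in\mathbb{F}_p^n\setminus\{(0,\ldots,0)\}$ such that $|l(\vec v,\mathbf{c})\cap\mathscr{U}_{\mathfrak{L}_i}|=1$ for each $1\leq i\leq r$, and $l(\vec v,\mathbf{c})\cap\mathscr{U}_{\mathfrak{L}_i}\neq l(\vec v,\mathbf{c})\cap\mathscr{U}_{\mathfrak{L}_j}$ for each $1\leq i<j\leq r$.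
   Context: $\mathbb{F}_p$ is the field with $p$ elements. For a linear function $\mathfrak{L}(x_1,\ldots,x_n)=a_1x_1+\cdots+a_nx_n+b$ over $\mathbb{F}_p$ with $a_1,\ldots,a_n$ not all zero, the hyperplane is $\mathscr{U}_{\mathfrak{L}}=\{x\in\mathbb{F}_p^n:\mathfrak{L}(x)=0\}$. For $\vec v=(v_1,\ldots,v_n)\neq0$ and $\mathbf{c}=(c_1,\ldots,c_n)$ in $\mathbb{F}_p^n$, $l(\vec v,\mathbf{c})=\{(v_1t+c_1,\ldots,v_nt+c_n):t\in\mathbb{F}_p\}$ is the line through $\mathbf{c}$ with direction $\vec v$. -}

module Defs where

open import Data.Nat using (ℕ; zero; suc; _+_; _*_; NonZero)
open import Data.Nat.DivMod using (_mod_)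
open import Data.Fin using (Fin; toℕ)
open import Data.Vec using (Vec; lookup; tabulate)
open import Data.Product using (Σ; ∃; _×_)
open import Relation.Binary.PropositionalEquality using (_≡_; _≢_)
open import Relation.Nullary using (¬_)
open import Function.Bundles using (_⇔_)

-- The field F_p, represented by Fin p with arithmetic modulo p.
𝔽 : ℕ → Set
𝔽 p = Fin p

Pt : ℕ → ℕ → Set
Pt p n = Vec (𝔽 p) n

PtSet : ℕ → ℕ → Set₁
PtSet p n = Pt p n → Set

∑ : (n : ℕ) → (Fin n → ℕ) → ℕ
∑ zero f = 0
∑ (suc n) f = f Fin.zero + ∑ n (λ i → f (Fin.suc i))

record LinFun (p n : ℕ) : Set where
  field
    coef    : Vec (𝔽 p) n
    const   : 𝔽 p
    nonzero : Σ (Fin n) (λ k → toℕ (lookup coef k) ≢ 0)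

open LinFun public

evalL : ∀ {p n} .{{_ : NonZero p}} → LinFun p n → Pt p n → 𝔽 p
evalL {p} {n} L x =
  (∑ n (λ k → toℕ (lookup (coef L) k) * toℕ (lookup x k)) + toℕ (const L)) mod p

hyperplane : ∀ {p n} .{{_ : NonZero p}} → LinFun p n → PtSet p n
hyperplane L x = toℕ (evalL L x) ≡ 0

linePt : ∀ {p n} .{{_ : NonZero p}} → Pt p n → Pt p n → 𝔽 p → Pt p n
linePt {p} v c t = tabulate (λ k → (toℕ (lookup v k) * toℕ t + toℕ (lookup c k)) mod p)

line : ∀ {p n} .{{_ : NonZero p}} → Pt p n → Pt p n → PtSet p n
line v c x = Σ (𝔽 _) (λ t → x ≡ linePt v c t)

_∩_ : ∀ {p n} → PtSet p n → PtSet p n → PtSet p n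
(A ∩ B) x = A x × B x

_≐_ : ∀ {p n} → PtSet p n → PtSet p n → Set
A ≐ B = ∀ x → A x ⇔ B x

HasExactlyOne : ∀ {p n} → PtSet p n → Set
HasExactlyOne A = Σ _ (λ x → A x × (∀ y → A y → y ≡ x))

zeroVec : ∀ {p n} .{{_ : NonZero p}} → Pt p n
zeroVec {p} = tabulate (λ _ → 0 mod p)

{-# OPTIONS --safe #-}
module Submission where

-- Write αᵢ(v) for the linear part of 𝔏ᵢ at v and ℓᵢ = 𝔏ᵢ(c). On the line t ↦ vt + c the
-- function 𝔏ᵢ is the affine function αᵢ(v) t + ℓᵢ, so the line meets 𝒰ᵢ in exactly one point
-- as soon as αᵢ(v) ≠ 0. A common point of the line with 𝒰ᵢ and 𝒰ⱼ, at parameter t, gives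
-- (ℓᵢ αⱼ(v) − ℓⱼ αᵢ(v)) t = 0, and t = 0 is impossible as c lies on at most one of the two.
-- So it suffices that v avoids the kernels of the r forms αᵢ and of the C(r,2) forms
-- ℓᵢ αⱼ − ℓⱼ αᵢ; the latter are nonzero because the hyperplanes are distinct and c is off
-- their pairwise intersections. Fewer than p nonzero linear forms never cover 𝔽ₚⁿ: choosing
-- the coordinates of v one at a time, each form whose current coordinate has a nonzero
-- coefficient excludes at most one value of that coordinate.

open import Data.Nat
open import Data.Nat.Properties
open import Data.Nat.DivMod
open import Data.Nat.Divisibility using (m%n≡0⇒n∣m; n∣m⇒m%n≡0)
open import Data.Nat.Primality using (Prime; euclidsLemma; prime⇒nonZero)
open import Data.Nat.Combinatorics using (_C_; nC1≡n; nCk+nC[k+1]≡[n+1]C[k+1])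
open import Data.Nat.Tactic.RingSolver using (solve-∀)
open import Data.Fin using (Fin; toℕ; punchOut) renaming (_<_ to _<ᶠ_)
import Data.Fin as Fin
open import Data.Fin.Properties
  using (toℕ<n; toℕ-injective; toℕ-fromℕ<; any?; all?; punchOut-injective; <⇒notInjective) renaming (<⇒≢ to <ᶠ⇒≢)
open import Data.Vec using ([]; _∷_; lookup)
open import Data.List using (List; []; _∷_; _++_; map; length; allFin)
import Data.List as List
open import Data.List.Properties using (length-++; length-map; length-tabulate)
open import Data.List.Membership.Propositional using (_∈_)
open import Data.List.Membership.Propositional.Properties using (∈-allFin; ∈-map⁺; ∈-++⁺ˡ; ∈-++⁺ʳ)
open import Data.List.Relation.Unary.Any using (here; there; index)
open import Data.List.Relation.Unary.Any.Properties using (lookup-index)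
open import Data.Product using (Σ; ∃; _×_; _,_; proj₁; proj₂)
open import Data.Sum using (_⊎_; inj₁; inj₂; [_,_])
open import Data.Empty using (⊥-elim)
open import Function using (_∘_)
open import Function.Bundles using (_⇔_; mk⇔; Equivalence)
open import Function.Definitions using (Injective)
open import Relation.Nullary using (¬_; Dec; yes; no; contradiction)
open import Relation.Nullary.Decidable using (map′; ¬?; _×-dec_; decidable-stable)
open import Relation.Binary.Bundles using (Setoid)
open import Relation.Binary.Structures using (IsEquivalence)
open import Relation.Binary.PropositionalEquality hiding ([_])
import Relation.Binary.Reasoning.Setoid as SetoidReasoning
open import Defs

injective⇒surjective : ∀ {n} {f : Fin n → Fin n} → Injective _≡_ _≡_ f → ∀ y → ∃ λ x → f x ≡ y
injective⇒surjective {suc n} {f} f-injective y with any? (λ x → f x Fin.≟ y)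
... | yes hit  = hit
... | no miss = ⊥-elim (<⇒notInjective (n<1+n n) g-injective)
  where
  y≢f : ∀ x → y ≢ f x
  y≢f x y≡fx = miss (x , sym y≡fx)

  g : Fin (suc n) → Fin n
  g x = punchOut (y≢f x)

  g-injective : Injective _≡_ _≡_ g
  g-injective gx≡gx′ = f-injective (punchOut-injective (y≢f _) (y≢f _) gx≡gx′)

dot : ∀ {p n} → (Fin n → ℕ) → Pt p n → ℕ
dot {n = n} w x = ∑ n (λ k → w k * toℕ (lookup x k))

dot-+ : ∀ {p n} (f g : Fin n → ℕ) (x : Pt p n) → dot (λ k → f k + g k) x ≡ dot f x + dot g x
dot-+ f g [] = refl
dot-+ f g (x₀ ∷ x) =
  trans (cong ((f Fin.zero + g Fin.zero) * toℕ x₀ +_) (dot-+ (f ∘ Fin.suc) (g ∘ Fin.suc) x))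
        (regroup (f Fin.zero) (g Fin.zero) (toℕ x₀) (dot (f ∘ Fin.suc) x) (dot (g ∘ Fin.suc) x))
  where
  regroup : ∀ a b y c d → (a + b) * y + (c + d) ≡ (a * y + c) + (b * y + d)
  regroup = solve-∀

dot-*ˡ : ∀ {p n} a (f : Fin n → ℕ) (x : Pt p n) → dot (λ k → a * f k) x ≡ a * dot f x
dot-*ˡ a f [] = sym (*-zeroʳ a)
dot-*ˡ a f (x₀ ∷ x) =
  trans (cong (a * f Fin.zero * toℕ x₀ +_) (dot-*ˡ a (f ∘ Fin.suc) x))
        (factor a (f Fin.zero) (toℕ x₀) (dot (f ∘ Fin.suc) x))
  where
  factor : ∀ a b y c → a * b * y + a * c ≡ a * (b * y + c)
  factor = solve-∀

module _ {a} {A : Set a} where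

  upperTriangle : ∀ {r} → (Fin r → A) → (Fin r → Fin r → A) → List A
  upperTriangle {zero}  f g = []
  upperTriangle {suc r} f g =
    f Fin.zero ∷ map (g Fin.zero ∘ Fin.suc) (allFin r) ++
    upperTriangle (f ∘ Fin.suc) (λ i j → g (Fin.suc i) (Fin.suc j))

  ∈-upperTriangle-diagonal : ∀ {r} (f : Fin r → A) g i → f i ∈ upperTriangle f g
  ∈-upperTriangle-diagonal f g Fin.zero    = here refl
  ∈-upperTriangle-diagonal f g (Fin.suc i) =
    there (∈-++⁺ʳ _ (∈-upperTriangle-diagonal (f ∘ Fin.suc) _ i))

  ∈-upperTriangle-above : ∀ {r} (f : Fin r → A) g {i j} → i <ᶠ j → g i j ∈ upperTriangle f g
  ∈-upperTriangle-above f g {Fin.zero}  {Fin.suc j} _ =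
    there (∈-++⁺ˡ (∈-map⁺ (g Fin.zero ∘ Fin.suc) (∈-allFin j)))
  ∈-upperTriangle-above f g {Fin.suc i} {Fin.suc j} (s≤s i<j) =
    there (∈-++⁺ʳ _ (∈-upperTriangle-above (f ∘ Fin.suc) _ i<j))

  length-upperTriangle : ∀ {r} (f : Fin r → A) g → length (upperTriangle f g) ≡ suc r C 2
  length-upperTriangle {zero}  f g = refl
  length-upperTriangle {suc r} f g = begin
    suc (length (map g₀ (allFin r) ++ rest))         ≡⟨ cong suc (length-++ (map g₀ (allFin r))) ⟩
    suc (length (map g₀ (allFin r)) + length rest)   ≡⟨ cong (λ m → suc (m + length rest)) length-row ⟩
    suc r + length rest                              ≡⟨ cong (suc r +_) (length-upperTriangle (f ∘ Fin.suc) _) ⟩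
    suc r + suc r C 2                                ≡⟨ cong (_+ suc r C 2) (nC1≡n (suc r)) ⟨
    suc r C 1 + suc r C 2                            ≡⟨ nCk+nC[k+1]≡[n+1]C[k+1] (suc r) 1 ⟩
    suc (suc r) C 2                                  ∎
    where
    open ≡-Reasoning
    g₀ : Fin r → A
    g₀ = g Fin.zero ∘ Fin.suc
    rest : List A
    rest = upperTriangle (f ∘ Fin.suc) (λ i j → g (Fin.suc i) (Fin.suc j))
    length-row : length (map g₀ (allFin r)) ≡ r
    length-row = trans (length-map g₀ (allFin r)) (length-tabulate {n = r} (λ i → i))

module Residues (q : ℕ) where

  p : ℕ
  p = suc q

  infix 4 _≋_ _≋?_
  record _≋_ (x y : ℕ) : Set where
    constructor mod-≡
    field mod-≡⁻¹ : x % p ≡ y % p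
  open _≋_ public

  ≋-isEquivalence : IsEquivalence _≋_
  ≋-isEquivalence = record
    { refl  = mod-≡ refl
    ; sym   = λ (mod-≡ e) → mod-≡ (sym e)
    ; trans = λ (mod-≡ e) (mod-≡ e′) → mod-≡ (trans e e′)
    }

  ≋-setoid : Setoid _ _
  ≋-setoid = record { isEquivalence = ≋-isEquivalence }

  open IsEquivalence ≋-isEquivalence public
    using () renaming (refl to ≋-refl; sym to ≋-sym; trans to ≋-trans; reflexive to ≋-reflexive)

  _≋?_ : ∀ x y → Dec (x ≋ y)
  x ≋? y = map′ mod-≡ mod-≡⁻¹ (x % p ≟ y % p)

  ≋⇒≡ : ∀ {x y} → x < p → y < p → x ≋ y → x ≡ y
  ≋⇒≡ x<p y<p (mod-≡ e) = trans (sym (m<n⇒m%n≡m x<p)) (trans e (m<n⇒m%n≡m y<p))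

  ≋0⇒≡0 : ∀ {x} → x < p → x ≋ 0 → x ≡ 0
  ≋0⇒≡0 x<p = ≋⇒≡ x<p (s≤s z≤n)

  toℕ-mod : ∀ x → toℕ (x mod p) ≋ x
  toℕ-mod x = mod-≡ (trans (cong (_% p) (toℕ-fromℕ< (m%n<n x p))) (m%n%n≡m%n x p))

  +-cong-≋ : ∀ {a b c d} → a ≋ b → c ≋ d → a + c ≋ b + d
  +-cong-≋ {a} {b} {c} {d} (mod-≡ e) (mod-≡ e′) = mod-≡ (begin
    (a + c) % p           ≡⟨ %-distribˡ-+ a c p ⟩
    (a % p + c % p) % p   ≡⟨ cong₂ (λ x y → (x + y) % p) e e′ ⟩
    (b % p + d % p) % p   ≡⟨ %-distribˡ-+ b d p ⟨
    (b + d) % p           ∎)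
    where open ≡-Reasoning

  *-cong-≋ : ∀ {a b c d} → a ≋ b → c ≋ d → a * c ≋ b * d
  *-cong-≋ {a} {b} {c} {d} (mod-≡ e) (mod-≡ e′) = mod-≡ (begin
    (a * c) % p             ≡⟨ %-distribˡ-* a c p ⟩
    (a % p * (c % p)) % p   ≡⟨ cong₂ (λ x y → (x * y) % p) e e′ ⟩
    (b % p * (d % p)) % p   ≡⟨ %-distribˡ-* b d p ⟨
    (b * d) % p             ∎)
    where open ≡-Reasoning

  -- Negation modulo p as multiplication by p − 1, avoiding truncated subtraction.
  infix 8 -_
  -_ : ℕ → ℕ
  - x = q * x

  -‿inverseʳ : ∀ x → x + - x ≋ 0
  -‿inverseʳ x = mod-≡ (trans (cong (_% p) (*-comm p x)) (m*n%n≡0 x p))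

  -‿inverseˡ : ∀ x → - x + x ≋ 0
  -‿inverseˡ x = ≋-trans (≋-reflexive (+-comm (- x) x)) (-‿inverseʳ x)

  +-cancelʳ-≋ : ∀ {x y} z → x + z ≋ y + z → x ≋ y
  +-cancelʳ-≋ {x} {y} z x+z≋y+z = begin
    x                ≡⟨ +-identityʳ x ⟨
    x + 0            ≈⟨ +-cong-≋ ≋-refl (-‿inverseʳ z) ⟨
    x + (z + - z)    ≡⟨ +-assoc x z (- z) ⟨
    (x + z) + - z    ≈⟨ +-cong-≋ x+z≋y+z ≋-refl ⟩
    (y + z) + - z    ≡⟨ +-assoc y z (- z) ⟩
    y + (z + - z)    ≈⟨ +-cong-≋ ≋-refl (-‿inverseʳ z) ⟩
    y + 0            ≡⟨ +-identityʳ y ⟩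
    y                ∎
    where open SetoidReasoning ≋-setoid

  +-cancelˡ-≋ : ∀ {x y} z → z + x ≋ z + y → x ≋ y
  +-cancelˡ-≋ {x} {y} z z+x≋z+y =
    +-cancelʳ-≋ z (≋-trans (≋-reflexive (+-comm x z)) (≋-trans z+x≋z+y (≋-reflexive (+-comm z y))))

  x+y≋0⇒x≋-y : ∀ {x y} → x + y ≋ 0 → x ≋ - y
  x+y≋0⇒x≋-y {y = y} x+y≋0 = +-cancelʳ-≋ y (≋-trans x+y≋0 (≋-sym (-‿inverseˡ y)))

  x+-y≋0⇒x≋y : ∀ {x y} → x + - y ≋ 0 → x ≋ y
  x+-y≋0⇒x≋y {y = y} x-y≋0 = +-cancelʳ-≋ (- y) (≋-trans x-y≋0 (≋-sym (-‿inverseʳ y)))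

  *-≋0ʳ : ∀ a {x} → x ≋ 0 → a * x ≋ 0
  *-≋0ʳ a x≋0 = ≋-trans (*-cong-≋ (≋-refl {a}) x≋0) (≋-reflexive (*-zeroʳ a))

  zero-root⇒constant≋0 : ∀ a b {t} → t ≋ 0 → a * t + b ≋ 0 → b ≋ 0
  zero-root⇒constant≋0 a b t≋0 root =
    ≋-trans (≋-sym (+-cong-≋ (*-≋0ʳ a t≋0) (≋-refl {b}))) root

  common-root⇒cross*root≋0 : ∀ a b c d t → a * t + b ≋ 0 → c * t + d ≋ 0 → (b * c + - d * a) * t ≋ 0
  common-root⇒cross*root≋0 a b c d t root₁ root₂ = begin
    (b * c + - d * a) * t          ≡⟨ expand b c (- d) a t ⟩
    b * (c * t) + - d * (a * t)    ≈⟨ +-cong-≋ (*-cong-≋ (≋-refl {b}) (x+y≋0⇒x≋-y root₂))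
                                               (*-cong-≋ (≋-refl { - d}) (x+y≋0⇒x≋-y root₁)) ⟩
    b * - d + - d * - b            ≡⟨ regroup b d q ⟩
    - d * b + - (- d * b)          ≈⟨ -‿inverseʳ (- d * b) ⟩
    0                              ∎
    where
    open SetoidReasoning ≋-setoid
    expand : ∀ b c e a t → (b * c + e * a) * t ≡ b * (c * t) + e * (a * t)
    expand = solve-∀
    regroup : ∀ b d q → b * (q * d) + q * d * (q * b) ≡ q * d * b + q * (q * d * b)
    regroup = solve-∀

  NonZeroForm : ∀ {n} → (Fin n → ℕ) → Set
  NonZeroForm w = ∃ λ k → ¬ w k ≋ 0

  dot-cong : ∀ {n} {f g : Fin n → ℕ} → (∀ k → f k ≋ g k) → (x : Pt p n) → dot f x ≋ dot g x
  dot-cong f≋g []       = ≋-refl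
  dot-cong f≋g (x₀ ∷ x) = +-cong-≋ (*-cong-≋ (f≋g Fin.zero) ≋-refl) (dot-cong (f≋g ∘ Fin.suc) x)

  dot-zeroVec : ∀ {n} (w : Fin n → ℕ) → dot w (zeroVec {p} {n}) ≡ 0
  dot-zeroVec {zero}  w = refl
  dot-zeroVec {suc n} w =
    trans (cong (_+ dot (w ∘ Fin.suc) (zeroVec {p} {n})) (*-zeroʳ (w Fin.zero))) (dot-zeroVec (w ∘ Fin.suc))

  dot-linePt : ∀ {n} (w : Fin n → ℕ) (v c : Pt p n) t → dot w (linePt v c t) ≋ dot w v * toℕ t + dot w c
  dot-linePt w [] [] t = ≋-refl
  dot-linePt w (v₀ ∷ v) (c₀ ∷ c) t = begin
    w₀ * toℕ ((toℕ v₀ * T + toℕ c₀) mod p) + dot w′ (linePt v c t)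
      ≈⟨ +-cong-≋ (*-cong-≋ (≋-refl {w₀}) (toℕ-mod (toℕ v₀ * T + toℕ c₀))) (dot-linePt w′ v c t) ⟩
    w₀ * (toℕ v₀ * T + toℕ c₀) + (dot w′ v * T + dot w′ c)
      ≡⟨ regroup w₀ (toℕ v₀) (toℕ c₀) T (dot w′ v) (dot w′ c) ⟩
    (w₀ * toℕ v₀ + dot w′ v) * T + (w₀ * toℕ c₀ + dot w′ c)
      ∎
    where
    open SetoidReasoning ≋-setoid
    w₀ : ℕ
    w₀ = w Fin.zero
    w′ : Fin _ → ℕ
    w′ = w ∘ Fin.suc
    T : ℕ
    T = toℕ t
    regroup : ∀ a b c t x y → a * (b * t + c) + (x * t + y) ≡ (a * b + x) * t + (a * c + y)
    regroup = solve-∀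

module PrimeResidues (q : ℕ) (p-prime : Prime (suc q)) where

  open Residues q

  m*n≋0⇒m≋0⊎n≋0 : ∀ m n → m * n ≋ 0 → m ≋ 0 ⊎ n ≋ 0
  m*n≋0⇒m≋0⊎n≋0 m n (mod-≡ mn≡0) with euclidsLemma m n p-prime (m%n≡0⇒n∣m _ p mn≡0)
  ... | inj₁ p∣m = inj₁ (mod-≡ (n∣m⇒m%n≡0 m p p∣m))
  ... | inj₂ p∣n = inj₂ (mod-≡ (n∣m⇒m%n≡0 n p p∣n))

  *-cancel-≋0 : ∀ {a x} → ¬ a ≋ 0 → a * x ≋ 0 → x ≋ 0
  *-cancel-≋0 {a} {x} a≢0 ax≋0 with m*n≋0⇒m≋0⊎n≋0 a x ax≋0
  ... | inj₁ a≋0 = contradiction a≋0 a≢0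
  ... | inj₂ x≋0 = x≋0

  *-cancelˡ-≋-≤ : ∀ {a i j} → ¬ a ≋ 0 → i ≤ j → j < p → a * i ≋ a * j → i ≡ j
  *-cancelˡ-≋-≤ {a} {i} {j} a≢0 i≤j j<p ai≋aj =
    ≤-antisym i≤j (m∸n≡0⇒m≤n (≋0⇒≡0 (≤-<-trans (m∸n≤m j i) j<p) (*-cancel-≋0 a≢0 a[j∸i]≋0)))
    where
    open SetoidReasoning ≋-setoid
    a[j∸i]≋0 : a * (j ∸ i) ≋ 0
    a[j∸i]≋0 = +-cancelˡ-≋ (a * i) (begin
      a * i + a * (j ∸ i)   ≡⟨ *-distribˡ-+ a i (j ∸ i) ⟨
      a * (i + (j ∸ i))     ≡⟨ cong (a *_) (m+[n∸m]≡n i≤j) ⟩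
      a * j                 ≈⟨ ai≋aj ⟨
      a * i                 ≡⟨ +-identityʳ (a * i) ⟨
      a * i + 0             ∎)

  *-cancelˡ-≋ : ∀ {a i j} → ¬ a ≋ 0 → a * i ≋ a * j → i < p → j < p → i ≡ j
  *-cancelˡ-≋ {i = i} {j} a≢0 ai≋aj i<p j<p with ≤-total i j
  ... | inj₁ i≤j = *-cancelˡ-≋-≤ a≢0 i≤j j<p ai≋aj
  ... | inj₂ j≤i = sym (*-cancelˡ-≋-≤ a≢0 j≤i i<p (≋-sym ai≋aj))

  common-root⇒cross≋0⊎constants≋0 : ∀ a b c d t → a * t + b ≋ 0 → c * t + d ≋ 0 →
    b * c + - d * a ≋ 0 ⊎ (b ≋ 0 × d ≋ 0)
  common-root⇒cross≋0⊎constants≋0 a b c d t root₁ root₂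
    with m*n≋0⇒m≋0⊎n≋0 (b * c + - d * a) t (common-root⇒cross*root≋0 a b c d t root₁ root₂)
  ... | inj₁ cross≋0 = inj₁ cross≋0
  ... | inj₂ t≋0     = inj₂ (zero-root⇒constant≋0 a b t≋0 root₁ , zero-root⇒constant≋0 c d t≋0 root₂)

  affine-injective : ∀ {a b} → ¬ a ≋ 0 → {s t : Fin p} → a * toℕ s + b ≋ a * toℕ t + b → s ≡ t
  affine-injective {b = b} a≢0 {s} {t} as+b≋at+b =
    toℕ-injective (*-cancelˡ-≋ a≢0 (+-cancelʳ-≋ b as+b≋at+b) (toℕ<n s) (toℕ<n t))

  affine-root : ∀ {a} b → ¬ a ≋ 0 → ∃ λ (t : Fin p) → a * toℕ t + b ≋ 0
  affine-root {a} b a≢0 =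
    let t , ft≡0 = injective⇒surjective f-injective Fin.zero
    in  t , ≋-trans (≋-sym (toℕ-mod _)) (≋-reflexive (cong toℕ ft≡0))
    where
    f : Fin p → Fin p
    f t = (a * toℕ t + b) mod p

    f-injective : Injective _≡_ _≡_ f
    f-injective {s} {t} fs≡ft = affine-injective a≢0
      (≋-trans (≋-sym (toℕ-mod _)) (≋-trans (≋-reflexive (cong toℕ fs≡ft)) (toℕ-mod _)))

  module _ {m} (a b : Fin m → ℕ) where

    NonconstantRoot : Fin p → Fin m → Set
    NonconstantRoot t i = ¬ a i ≋ 0 × a i * toℕ t + b i ≋ 0

    nonconstantRoot? : ∀ t i → Dec (NonconstantRoot t i)
    nonconstantRoot? t i = ¬? (a i ≋? 0) ×-dec (a i * toℕ t + b i ≋? 0)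

    -- If no t worked, every t would be a root of some nonconstant aᵢ t + bᵢ; as such a function
    -- has only one root, t ↦ i would inject Fin p into Fin m.
    avoid-affine-zeros : m < p → ∃ λ t → ∀ i → ¬ NonconstantRoot t i
    avoid-affine-zeros m<p =
      decidable-stable (any? λ t → all? λ i → ¬? (nonconstantRoot? t i))
        (λ none → <⇒notInjective m<p (culprit-injective none))
      where
      module _ (none : ¬ ∃ λ t → ∀ i → ¬ NonconstantRoot t i) where
        culprit : ∀ t → ∃ (NonconstantRoot t)
        culprit t = decidable-stable (any? (nonconstantRoot? t)) (λ free → none (t , λ i r → free (i , r)))

        culprit-injective : Injective _≡_ _≡_ (proj₁ ∘ culprit)
        culprit-injective {s} {t} same =
          let aᵢ≢0 , s-root = proj₂ (culprit s)
              _    , t-root = subst (NonconstantRoot t) (sym same) (proj₂ (culprit t))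
          in affine-injective aᵢ≢0 (≋-trans s-root (≋-sym t-root))

  avoid-linear-zeros : ∀ {m n} → m < p → (w : Fin m → Fin n → ℕ) →
    ∃ λ (v : Pt p n) → ∀ i → NonZeroForm (w i) → ¬ dot (w i) v ≋ 0
  avoid-linear-zeros {n = zero} m<p w = [] , λ i ()
  avoid-linear-zeros {n = suc n} m<p w
    with v , v-ok ← avoid-linear-zeros m<p (λ i → w i ∘ Fin.suc)
    with t , t-ok ← avoid-affine-zeros (λ i → w i Fin.zero) (λ i → dot (w i ∘ Fin.suc) v) m<p
    = t ∷ v , avoids
    where
    avoids : ∀ i → NonZeroForm (w i) → ¬ dot (w i) (t ∷ v) ≋ 0
    avoids i (k , wᵢₖ≢0) with w i Fin.zero ≋? 0
    ... | no wᵢ₀≢0 = λ root → t-ok i (wᵢ₀≢0 , root)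
    ... | yes wᵢ₀≋0 = λ root → v-ok i (tail-nonzero k wᵢₖ≢0) (begin
      dot (w i ∘ Fin.suc) v                          ≡⟨⟩
      0 * toℕ t + dot (w i ∘ Fin.suc) v              ≈⟨ +-cong-≋ (*-cong-≋ wᵢ₀≋0 ≋-refl) ≋-refl ⟨
      w i Fin.zero * toℕ t + dot (w i ∘ Fin.suc) v   ≈⟨ root ⟩
      0                                              ∎)
      where
      open SetoidReasoning ≋-setoid
      tail-nonzero : ∀ k → ¬ w i k ≋ 0 → NonZeroForm (w i ∘ Fin.suc)
      tail-nonzero Fin.zero    wᵢ₀≢0 = contradiction wᵢ₀≋0 wᵢ₀≢0
      tail-nonzero (Fin.suc k) wᵢₖ≢0 = k , wᵢₖ≢0

  avoid-linear-zeros-∈ : ∀ {n} (ws : List (Fin n → ℕ)) → length ws < p →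
    ∃ λ (v : Pt p n) → ∀ {w} → w ∈ ws → NonZeroForm w → ¬ dot w v ≋ 0
  avoid-linear-zeros-∈ ws bound with v , v-ok ← avoid-linear-zeros bound (List.lookup ws) =
    v , λ w∈ws →
      subst (λ w → NonZeroForm w → ¬ dot w v ≋ 0) (sym (lookup-index w∈ws)) (v-ok (index w∈ws))

module Geometry (q : ℕ) (p-prime : Prime (suc q)) where

  open Residues q
  open PrimeResidues q p-prime

  coefficients : ∀ {n} → LinFun p n → Fin n → ℕ
  coefficients L k = toℕ (lookup (coef L) k)

  affine : ∀ {n} → LinFun p n → Pt p n → ℕ
  affine L x = dot (coefficients L) x + toℕ (const L)

  coefficients-nonZero : ∀ {n} (L : LinFun p n) → NonZeroForm (coefficients L)
  coefficients-nonZero L = let k , aₖ≢0 = nonzero L in k , aₖ≢0 ∘ ≋0⇒≡0 (toℕ<n _)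

  ∈hyperplane⇔ : ∀ {n} (L : LinFun p n) x → hyperplane L x ⇔ affine L x ≋ 0
  ∈hyperplane⇔ L x = mk⇔
    (λ on → ≋-trans (≋-sym (toℕ-mod (affine L x))) (≋-reflexive on))
    (λ L[x]≋0 → ≋0⇒≡0 (toℕ<n _) (≋-trans (toℕ-mod (affine L x)) L[x]≋0))

  linePt∈hyperplane⇔ : ∀ {n} (L : LinFun p n) v c t →
    hyperplane L (linePt v c t) ⇔ dot (coefficients L) v * toℕ t + affine L c ≋ 0
  linePt∈hyperplane⇔ L v c t = mk⇔
    (λ on → ≋-trans (≋-sym restriction) (Equivalence.to (∈hyperplane⇔ L (linePt v c t)) on))
    (λ root → Equivalence.from (∈hyperplane⇔ L (linePt v c t)) (≋-trans restriction root))
    where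
    restriction : affine L (linePt v c t) ≋ dot (coefficients L) v * toℕ t + affine L c
    restriction = ≋-trans (+-cong-≋ (dot-linePt (coefficients L) v c t) ≋-refl)
                          (≋-reflexive (+-assoc (dot (coefficients L) v * toℕ t) _ _))

  line-meets-hyperplane-once : ∀ {n} (L : LinFun p n) v c → ¬ dot (coefficients L) v ≋ 0 →
    HasExactlyOne (line v c ∩ hyperplane L)
  line-meets-hyperplane-once L v c α≢0 =
    let t , root = affine-root (affine L c) α≢0
    in  linePt v c t , ((t , refl) , Equivalence.from (linePt∈hyperplane⇔ L v c t) root) , unique t root
    where
    unique : ∀ t → dot (coefficients L) v * toℕ t + affine L c ≋ 0 →
      ∀ y → (line v c ∩ hyperplane L) y → y ≡ linePt v c t
    unique t root _ ((s , refl) , on) = cong (linePt v c)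
      (affine-injective α≢0 (≋-trans (Equivalence.to (linePt∈hyperplane⇔ L v c s) on) (≋-sym root)))

  -- dot (cross L M c) v vanishes exactly when the line through c in direction v meets 𝒰_L and
  -- 𝒰_M at the same parameter t, namely t = −L(c) / α_L(v) = −M(c) / α_M(v).
  cross : ∀ {n} → LinFun p n → LinFun p n → Pt p n → Fin n → ℕ
  cross L M c k = affine L c * coefficients M k + - affine M c * coefficients L k

  dot-cross : ∀ {n} (L M : LinFun p n) c (x : Pt p n) →
    dot (cross L M c) x ≡ affine L c * dot (coefficients M) x + - affine M c * dot (coefficients L) x
  dot-cross L M c x =
    trans (dot-+ (λ k → affine L c * coefficients M k) (λ k → - affine M c * coefficients L k) x)
          (cong₂ _+_ (dot-*ˡ (affine L c) (coefficients M) x) (dot-*ˡ (- affine M c) (coefficients L) x))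

  proportional-zero : ∀ {n} (L M : LinFun p n) {ℓ m} →
    (∀ k → ℓ * coefficients M k ≋ m * coefficients L k) → ℓ ≋ 0 → m ≋ 0
  proportional-zero L M {ℓ} {m} prop ℓ≋0 =
    let k , aₖ≢0 = coefficients-nonZero L
    in  *-cancel-≋0 aₖ≢0 (begin
          coefficients L k * m   ≡⟨ *-comm (coefficients L k) m ⟩
          m * coefficients L k   ≈⟨ prop k ⟨
          ℓ * coefficients M k   ≈⟨ *-cong-≋ ℓ≋0 ≋-refl ⟩
          0                      ∎)
    where open SetoidReasoning ≋-setoid

  -- Both sides are affine in x with the same linear part, and they agree at x = c.
  proportional-affine : ∀ {n} (L M : LinFun p n) c →
    (∀ k → affine L c * coefficients M k ≋ affine M c * coefficients L k) →
    ∀ x → affine L c * affine M x ≋ affine M c * affine L x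
  proportional-affine {n} L M c prop x = begin
    ℓ * (α M x + β M)     ≡⟨ *-distribˡ-+ ℓ (α M x) (β M) ⟩
    ℓ * α M x + ℓ * β M   ≈⟨ +-cong-≋ (linear x) constant ⟩
    m * α L x + m * β L   ≡⟨ *-distribˡ-+ m (α L x) (β L) ⟨
    m * (α L x + β L)     ∎
    where
    open SetoidReasoning ≋-setoid
    ℓ m : ℕ
    ℓ = affine L c
    m = affine M c
    α : LinFun p n → Pt p n → ℕ
    α N = dot (coefficients N)
    β : LinFun p n → ℕ
    β N = toℕ (const N)

    linear : ∀ x → ℓ * α M x ≋ m * α L x
    linear x = begin
      ℓ * α M x                           ≡⟨ dot-*ˡ ℓ (coefficients M) x ⟨
      dot (λ k → ℓ * coefficients M k) x  ≈⟨ dot-cong prop x ⟩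
      dot (λ k → m * coefficients L k) x  ≡⟨ dot-*ˡ m (coefficients L) x ⟩
      m * α L x                           ∎

    constant : ℓ * β M ≋ m * β L
    constant = +-cancelˡ-≋ (m * α L c) (begin
      m * α L c + ℓ * β M   ≈⟨ +-cong-≋ (linear c) ≋-refl ⟨
      ℓ * α M c + ℓ * β M   ≡⟨ *-distribˡ-+ ℓ (α M c) (β M) ⟨
      ℓ * m                 ≡⟨ *-comm ℓ m ⟩
      m * ℓ                 ≡⟨ *-distribˡ-+ m (α L c) (β L) ⟩
      m * α L c + m * β L   ∎)

  proportional-hyperplanes : ∀ {n} (L M : LinFun p n) {ℓ m} → ¬ ℓ ≋ 0 → ¬ m ≋ 0 →
    (∀ x → ℓ * affine M x ≋ m * affine L x) → hyperplane L ≐ hyperplane M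
  proportional-hyperplanes L M {ℓ} {m} ℓ≢0 m≢0 prop x = mk⇔
    (λ onL → Equivalence.from (∈hyperplane⇔ M x) (*-cancel-≋0 ℓ≢0
      (≋-trans (prop x) (*-≋0ʳ m (Equivalence.to (∈hyperplane⇔ L x) onL)))))
    (λ onM → Equivalence.from (∈hyperplane⇔ L x) (*-cancel-≋0 m≢0
      (≋-trans (≋-sym (prop x)) (*-≋0ʳ ℓ (Equivalence.to (∈hyperplane⇔ M x) onM)))))

  proportional⇒degenerate : ∀ {n} (L M : LinFun p n) c →
    (∀ k → affine L c * coefficients M k ≋ affine M c * coefficients L k) →
    (hyperplane L ≐ hyperplane M) ⊎ (hyperplane L c × hyperplane M c)
  proportional⇒degenerate L M c prop with affine L c ≋? 0
  ... | yes L[c]≋0 = inj₂ (Equivalence.from (∈hyperplane⇔ L c) L[c]≋0 ,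
                           Equivalence.from (∈hyperplane⇔ M c) (proportional-zero L M {affine L c} prop L[c]≋0))
  ... | no L[c]≢0  = inj₁ (proportional-hyperplanes L M {affine L c} {affine M c} L[c]≢0
                             (L[c]≢0 ∘ proportional-zero M L {affine M c} (≋-sym ∘ prop))
                             (proportional-affine L M c prop))

  cross-nonZero : ∀ {n} (L M : LinFun p n) c → ¬ (hyperplane L ≐ hyperplane M) →
    ¬ (hyperplane L c × hyperplane M c) → NonZeroForm (cross L M c)
  cross-nonZero L M c L≠M c∉L∩M =
    decidable-stable (any? λ k → ¬? (cross L M c k ≋? 0))
      (λ vanishing → [ L≠M , c∉L∩M ] (proportional⇒degenerate L M c (proportional vanishing)))
    where
    proportional : ¬ NonZeroForm (cross L M c) →
      ∀ k → affine L c * coefficients M k ≋ affine M c * coefficients L k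
    proportional vanishing k = x+-y≋0⇒x≋y (≋-trans
      (≋-reflexive (cong (affine L c * coefficients M k +_) (sym (*-assoc q (affine M c) _))))
      (decidable-stable (cross L M c k ≋? 0) (λ ≢0 → vanishing (k , ≢0))))

  shared-root : ∀ {n} (L M : LinFun p n) v c →
    (line v c ∩ hyperplane L) ≐ (line v c ∩ hyperplane M) → ∀ t →
    dot (coefficients L) v * toℕ t + affine L c ≋ 0 → dot (coefficients M) v * toℕ t + affine M c ≋ 0
  shared-root L M v c same t rootL = Equivalence.to (linePt∈hyperplane⇔ M v c t)
    (proj₂ (Equivalence.to (same (linePt v c t))
                           ((t , refl) , Equivalence.from (linePt∈hyperplane⇔ L v c t) rootL)))

  line-separates : ∀ {n} (L M : LinFun p n) v c → ¬ dot (coefficients L) v ≋ 0 →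
    ¬ dot (cross L M c) v ≋ 0 → ¬ (hyperplane L c × hyperplane M c) →
    ¬ ((line v c ∩ hyperplane L) ≐ (line v c ∩ hyperplane M))
  line-separates L M v c α≢0 cross≢0 c∉L∩M same
    with t , rootL ← affine-root (affine L c) α≢0
    with common-root⇒cross≋0⊎constants≋0
           (dot (coefficients L) v) (affine L c) (dot (coefficients M) v) (affine M c) (toℕ t)
           rootL (shared-root L M v c same t rootL)
  ... | inj₁ cross≋0         = cross≢0 (≋-trans (≋-reflexive (dot-cross L M c v)) cross≋0)
  ... | inj₂ (L[c]≋0 , M[c]≋0) =
    c∉L∩M (Equivalence.from (∈hyperplane⇔ L c) L[c]≋0 , Equivalence.from (∈hyperplane⇔ M c) M[c]≋0)

lemma3p1 : (p n r : ℕ) → .{{_ : NonZero p}} → Prime p → n ≥ 1 → r ≥ 1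
    → (suc r C 2) < p
    → (L : Fin r → LinFun p n)
    → (∀ i j → i ≢ j → ¬ (hyperplane (L i) ≐ hyperplane (L j)))
    → (c : Pt p n)
    → (∀ i j → i <ᶠ j → ¬ ((hyperplane (L i) ∩ hyperplane (L j)) c))
    → Σ (Pt p n) (λ v → (v ≢ zeroVec)
        × ((∀ i → HasExactlyOne (line v c ∩ hyperplane (L i)))
        × (∀ i j → i <ᶠ j → ¬ ((line v c ∩ hyperplane (L i)) ≐ (line v c ∩ hyperplane (L j))))))
lemma3p1 zero _ _ p-prime _ _ _ _ _ _ _ = ⊥-elim (NonZero.nonZero (prime⇒nonZero p-prime))
lemma3p1 (suc q) n r@(suc _) p-prime _ _ bound L distinct c off-intersections =
  v , v≢0 , (λ i → line-meets-hyperplane-once (L i) v c (α≢0 i))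
          , (λ i j i<j → line-separates (L i) (L j) v c (α≢0 i) (cross≢0 i<j) (off-intersections i j i<j))
  where
  open Residues q
  open PrimeResidues q p-prime
  open Geometry q p-prime

  linearParts : Fin r → Fin n → ℕ
  linearParts = coefficients ∘ L

  crosses : Fin r → Fin r → Fin n → ℕ
  crosses i j = cross (L i) (L j) c

  avoiding : ∃ λ (v : Pt p n) →
    ∀ {w} → w ∈ upperTriangle linearParts crosses → NonZeroForm w → ¬ dot w v ≋ 0
  avoiding = avoid-linear-zeros-∈ (upperTriangle linearParts crosses)
    (subst (_< p) (sym (length-upperTriangle linearParts crosses)) bound)

  v : Pt p n
  v = proj₁ avoiding

  α≢0 : ∀ i → ¬ dot (coefficients (L i)) v ≋ 0
  α≢0 i = proj₂ avoiding (∈-upperTriangle-diagonal linearParts crosses i) (coefficients-nonZero (L i))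

  cross≢0 : ∀ {i j} → i <ᶠ j → ¬ dot (cross (L i) (L j) c) v ≋ 0
  cross≢0 {i} {j} i<j = proj₂ avoiding (∈-upperTriangle-above linearParts crosses i<j)
    (cross-nonZero (L i) (L j) c (distinct i j (<ᶠ⇒≢ i<j)) (off-intersections i j i<j))

  v≢0 : v ≢ zeroVec
  v≢0 v≡0 = α≢0 Fin.zero
    (≋-reflexive (trans (cong (dot (linearParts Fin.zero)) v≡0) (dot-zeroVec (linearParts Fin.zero))))
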